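{- For every propositional Hilbert-type calculus $\mathbf{C}$, the many-valued closure $\mathrm{MC}(\mathbf{C})$ is uniquely determined and has an effective sequential approximation.
   Context: A propositional language has variables $X_1,X_2,\dots$ and finitely many connectives with fixed arities. A propositional Hilbert-type calculus $\mathbf{C}$ consists of a finite set of axioms (formulas) and a finite set of rules (premises $A_1,\dots,A_n$, conclusion $C$). A finite-valued logic $\mathbf{M}$ consists of a finite set $V(\mathbf{M})$ of truth values, a subset $V^+(\mathbf{M})$ of designated values, and a truth function for each connective; valuations map variables to truth values and extend to formulas; $\mathrm{Taut}(\mathbf{M})$ is the set of formulas designated under every valuation. $\mathbf{M}$ is a cover for $\mathbf{C}$ if all axioms of $\mathbf{C}$ are tautologies of $\mathbf{M}$ and for every rule every valuation giving designated values to all premises gives a designated value to the conclusion. The many-valued closure $\mathrm{MC}(\mathbf{C})$ is the set of formulas that are tautologies of every finite-valued cover of $\mathbf{C}$. Write $\mathbf{M}\unlhd\mathbf{M}'$ if $\mathrm{Taut}(\mathbf{M})\subseteq\mathrm{Taut}(\mathbf{M}')$. An effective sequential approximation of a set of formulas $\mathbf{L}$ is a sequence $\langle\mathbf{M}_1,\mathbf{M}_2,\dots\rangle$ of finite-valued logics, computably enumerated (an algorithm outputs $\mathbf{M}_i$ on input $i$), with $\mathbf{M}_i\unlhd\mathbf{M}_j$ whenever $i\ge j$ and $\mathbf{L}=\bigcap_j\mathrm{Taut}(\mathbf{M}_j)$. -}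

module Defs where

open import Data.Nat using (ℕ; _≤_)
open import Data.Fin using (Fin)
open import Data.Bool using (Bool; T)
open import Data.Vec using (Vec; []; _∷_)
open import Data.List using (List)
open import Data.List.Relation.Unary.All using (All)
open import Data.Product using (Σ; _×_)
open import Function.Bundles using (_⇔_)

record Signature : Set where
  field
    nConn : ℕ
    arity : Fin nConn → ℕ
open Signature public

module _ (σ : Signature) where

  data Formula : Set where
    var : ℕ → Formula
    app : (c : Fin (nConn σ)) → Vec Formula (arity σ c) → Formula

  record Rule : Set where
    constructor rule
    field
      premises   : List Formula
      conclusion : Formula

  record Calculus : Set where
    constructor calculus
    field
      axioms : List Formula
      rules  : List Rule

  record Logic : Set where
    field
      size       : ℕ
      designated : Fin size → Bool
      op         : (c : Fin (nConn σ)) → Vec (Fin size) (arity σ c) → Fin size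

module _ {σ : Signature} (M : Logic σ) where
  open Logic M

  Valuation : Set
  Valuation = ℕ → Fin size

  mutual
    eval : Valuation → Formula σ → Fin size
    eval v (var x)    = v x
    eval v (app c as) = op c (evalVec v as)

    evalVec : ∀ {m} → Valuation → Vec (Formula σ) m → Vec (Fin size) m
    evalVec v []       = []
    evalVec v (a ∷ as) = eval v a ∷ evalVec v as

  Designated : Fin size → Set
  Designated x = T (designated x)

  Taut : Formula σ → Set
  Taut F = (v : Valuation) → Designated (eval v F)

  Sound : Rule σ → Set
  Sound r = (v : Valuation) →
            All (λ A → Designated (eval v A)) (Rule.premises r) →
            Designated (eval v (Rule.conclusion r))

  Cover : Calculus σ → Set
  Cover C = All Taut (Calculus.axioms C) × All Sound (Calculus.rules C)

module _ {σ : Signature} where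

  _⊴_ : Logic σ → Logic σ → Set
  M ⊴ M' = (F : Formula σ) → Taut M F → Taut M' F

  MC : Calculus σ → Formula σ → Set
  MC C F = (M : Logic σ) → Cover M C → Taut M F

  -- effective sequential approximation of a set of formulas L
  -- (an Agda function ℕ → Logic σ is by construction computable)
  EffectiveSeqApprox : (Formula σ → Set) → Set
  EffectiveSeqApprox L =
    Σ (ℕ → Logic σ) λ M →
      ((i j : ℕ) → j ≤ i → M i ⊴ M j) ×
      ((F : Formula σ) → L F ⇔ ((j : ℕ) → Taut (M j) F))

-- Tautologyhood in a finite logic, and soundness of a rule, depend only on
-- the finitely many variables occurring, so whether a finite logic covers C is decidable;
-- and there are only finitely many logics (truth tables) with t truth values. Let M_i be
-- the direct product of all covers with at most i truth values (non-covers replaced by the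
-- one-point logic). A formula is a tautology of a product of inhabited logics iff it is
-- one of each factor, so Taut(M_i) decreases with i and its intersection is MC(C).
module Submission where

open import Defs
open import Data.Nat using (ℕ; zero; suc; _≤_; _<_; _⊔_; _*_; _≤′_; ≤′-refl; ≤′-step; s≤s)
open import Data.Nat.Properties using (≤-trans; n<1+n; m≤m⊔n; m≤n⊔m; ≤⇒≤′)
open import Data.Fin using (Fin; zero; suc; combine; remQuot)
open import Data.Fin.Properties using (¬Fin0; remQuot-combine)
import Data.Fin.Properties as Fin
open import Data.Bool using (Bool; true; false; T; _∧_)
open import Data.Bool.Properties using (T?; T-∧)
open import Data.Vec using (Vec; []; _∷_)
import Data.Vec as Vec
open import Data.Vec.Properties using (map-id)
open import Data.List using (List; []; _∷_; map; allFin; cartesianProductWith)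
open import Data.List.Relation.Unary.All using (All; []; _∷_; lookupAny; universal)
import Data.List.Relation.Unary.All as All
import Data.List.Relation.Unary.All.Properties as All
open import Data.List.Relation.Unary.Any using (Any; here; there)
import Data.List.Relation.Unary.Any as Any
import Data.List.Relation.Unary.Any.Properties as Any
open import Data.List.Membership.Propositional.Properties using (∈-allFin)
open import Data.Product using (_×_; _,_; proj₁; proj₂; ∃-syntax)
open import Data.Unit using (tt)
open import Data.Empty using (⊥-elim)
open import Function using (_∘_; id)
open import Function.Bundles using (_⇔_; mk⇔; Equivalence)
open import Relation.Nullary using (Dec; yes; no)
open import Relation.Nullary.Decidable using (map′; _×-dec_; _→-dec_)
open import Relation.Binary.PropositionalEquality
  using (_≡_; _≗_; refl; sym; trans; cong; cong₂; subst)

open Logic using (size; designated; op)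

-- Complete only up to _≈_: without function extensionality, truth tables can only be
-- listed up to pointwise equality.
record Enumeration (A : Set) (_≈_ : A → A → Set) : Set where
  field
    list     : List A
    complete : ∀ a → Any (_≈ a) list
open Enumeration

representative : ∀ {A : Set} {R : A → A → Set} {P : A → Set} (E : Enumeration A R) →
                 All P (list E) → ∀ a → ∃[ b ] R b a × P b
representative E all a =
  let i = complete E a ; Pb , Rba = lookupAny all i in Any.lookup i , Rba , Pb

Bool-enumeration : Enumeration Bool _≡_
Bool-enumeration = record
  { list     = true ∷ false ∷ []
  ; complete = λ { true → here refl ; false → there (here refl) }
  }

Fin-enumeration : ∀ n → Enumeration (Fin n) _≡_
Fin-enumeration n = record
  { list     = allFin n
  ; complete = λ i → Any.map sym (∈-allFin i)
  }

×-enumeration : ∀ {A B : Set} {R : A → A → Set} {S : B → B → Set} →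
                Enumeration A R → Enumeration B S →
                Enumeration (A × B) (λ p q → R (proj₁ p) (proj₁ q) × S (proj₂ p) (proj₂ q))
×-enumeration EA EB = record
  { list     = cartesianProductWith _,_ (list EA) (list EB)
  ; complete = λ (a , b) → Any.cartesianProductWith⁺ _,_ _,_ (complete EA a) (complete EB b)
  }

Π-enumeration : ∀ n {F : Fin n → Set} {R : ∀ i → F i → F i → Set} →
                (∀ i → Enumeration (F i) (R i)) →
                Enumeration ((i : Fin n) → F i) (λ f g → ∀ i → R i (f i) (g i))
Π-enumeration zero E = record { list = (λ ()) ∷ [] ; complete = λ _ → here (λ ()) }
Π-enumeration (suc n) {F} {R} E = record
  { list     = cartesianProductWith cons (list (E zero)) (list tail)
  ; complete = λ f → Any.cartesianProductWith⁺ cons (λ r rs → λ { zero → r ; (suc i) → rs i })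
                       (complete (E zero) (f zero)) (complete tail (f ∘ suc))
  }
  where
    tail : Enumeration ((i : Fin n) → F (suc i)) (λ f g → ∀ i → R (suc i) (f i) (g i))
    tail = Π-enumeration n (λ i → E (suc i))
    cons : F zero → ((i : Fin n) → F (suc i)) → (i : Fin (suc n)) → F i
    cons x f zero    = x
    cons x f (suc i) = f i

Vec→-enumeration : ∀ n a {B : Set} {R : B → B → Set} → Enumeration B R →
                   Enumeration (Vec (Fin n) a → B) (λ f g → ∀ xs → R (f xs) (g xs))
Vec→-enumeration n zero E = record
  { list     = map (λ b _ → b) (list E)
  ; complete = λ f → Any.map⁺ (Any.map (λ r → λ { [] → r }) (complete E (f [])))
  }
Vec→-enumeration n (suc a) {B} {R} E = record
  { list     = map uncurryVec (list curried)
  ; complete = λ f → Any.map⁺ (Any.map (λ r → λ { (x ∷ xs) → r x xs })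
                                 (complete curried (λ x xs → f (x ∷ xs))))
  }
  where
    curried : Enumeration (Fin n → Vec (Fin n) a → B) (λ f g → ∀ x xs → R (f x xs) (g x xs))
    curried = Π-enumeration n (λ _ → Vec→-enumeration n a E)
    uncurryVec : (Fin n → Vec (Fin n) a → B) → Vec (Fin n) (suc a) → B
    uncurryVec f (x ∷ xs) = f x xs

_∷ₛ_ : {A : Set} → A → (ℕ → A) → ℕ → A
(a ∷ₛ v) zero    = a
(a ∷ₛ v) (suc x) = v x

AgreeBelow : {A : Set} → ℕ → (ℕ → A) → (ℕ → A) → Set
AgreeBelow n v v' = ∀ x → x < n → v x ≡ v' x

Local : {A : Set} → ℕ → ((ℕ → A) → Set) → Set
Local n P = ∀ {v v'} → AgreeBelow n v v' → P v → P v'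

Local-mono : ∀ {A : Set} {P : (ℕ → A) → Set} {m n} → m ≤ n → Local m P → Local n P
Local-mono m≤n loc ag = loc (λ x x<m → ag x (≤-trans x<m m≤n))

Local-→ : ∀ {A : Set} {P Q : (ℕ → A) → Set} {n} → Local n P → Local n Q →
          Local n (λ v → P v → Q v)
Local-→ locP locQ ag f p = locQ ag (f (locP (λ x x<n → sym (ag x x<n)) p))

∀-local? : ∀ k n {P : (ℕ → Fin k) → Set} → Local n P → (∀ v → Dec (P v)) → Dec (∀ v → P v)
∀-local? zero    n       loc P? = yes (λ v → ⊥-elim (¬Fin0 (v 0)))
∀-local? (suc k) zero    loc P? =
  map′ (λ p v → loc (λ _ ()) p) (λ h → h (λ _ → zero)) (P? (λ _ → zero))
∀-local? (suc k) (suc n) loc P? =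
  map′ (λ h v → loc head∷tail (h (v 0) (v ∘ suc))) (λ h a v → h (a ∷ₛ v))
       (Fin.all? (λ a → ∀-local? (suc k) n (λ ag → loc (∷ₛ-agree ag)) (λ v → P? (a ∷ₛ v))))
  where
    head∷tail : ∀ {v : ℕ → Fin (suc k)} → AgreeBelow (suc n) (v 0 ∷ₛ (v ∘ suc)) v
    head∷tail zero    _ = refl
    head∷tail (suc x) _ = refl
    ∷ₛ-agree : ∀ {a} {v v' : ℕ → Fin (suc k)} →
               AgreeBelow n v v' → AgreeBelow (suc n) (a ∷ₛ v) (a ∷ₛ v')
    ∷ₛ-agree ag zero    _         = refl
    ∷ₛ-agree ag (suc x) (s≤s x<n) = ag x x<n

π₁ : ∀ {m n} → Fin (m * n) → Fin m
π₁ {m} {n} i = proj₁ (remQuot {m} n i)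

π₂ : ∀ {m n} → Fin (m * n) → Fin n
π₂ {m} {n} i = proj₂ (remQuot {m} n i)

π₁-combine : ∀ {m n} (i : Fin m) (j : Fin n) → π₁ (combine i j) ≡ i
π₁-combine {m} {n} i j = cong proj₁ (remQuot-combine {m} {n} i j)

π₂-combine : ∀ {m n} (i : Fin m) (j : Fin n) → π₂ {m} (combine i j) ≡ j
π₂-combine {m} {n} i j = cong proj₂ (remQuot-combine {m} {n} i j)

module _ {σ : Signature} where

  mutual
    varBound : Formula σ → ℕ
    varBound (var x)    = suc x
    varBound (app c Fs) = varBoundVec Fs

    varBoundVec : ∀ {m} → Vec (Formula σ) m → ℕ
    varBoundVec []       = 0
    varBoundVec (F ∷ Fs) = varBound F ⊔ varBoundVec Fs

  varBoundList : List (Formula σ) → ℕ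
  varBoundList []       = 0
  varBoundList (F ∷ Fs) = varBound F ⊔ varBoundList Fs

  Holds : (M : Logic σ) → Valuation M → Formula σ → Set
  Holds M v F = Designated M (eval M v F)

  module _ (M : Logic σ) where

    mutual
      eval-local : ∀ {v v'} F → AgreeBelow (varBound F) v v' → eval M v F ≡ eval M v' F
      eval-local (var x)    ag = ag x (n<1+n x)
      eval-local (app c Fs) ag = cong (op M c) (evalVec-local Fs ag)

      evalVec-local : ∀ {m v v'} (Fs : Vec (Formula σ) m) → AgreeBelow (varBoundVec Fs) v v' →
                      evalVec M v Fs ≡ evalVec M v' Fs
      evalVec-local []       ag = refl
      evalVec-local (F ∷ Fs) ag =
        cong₂ _∷_ (eval-local F (λ x x< → ag x (≤-trans x< (m≤m⊔n _ _))))
                  (evalVec-local Fs (λ x x< → ag x (≤-trans x< (m≤n⊔m (varBound F) _))))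

    Holds-local : ∀ F → Local (varBound F) (λ v → Holds M v F)
    Holds-local F ag = subst (Designated M) (eval-local F ag)

    All-Holds-local : ∀ Fs → Local (varBoundList Fs) (λ v → All (Holds M v) Fs)
    All-Holds-local []       ag []       = []
    All-Holds-local (F ∷ Fs) ag (h ∷ hs) =
      Local-mono (m≤m⊔n _ _) (Holds-local F) ag h ∷
      Local-mono (m≤n⊔m (varBound F) _) (All-Holds-local Fs) ag hs

    taut? : ∀ F → Dec (Taut M F)
    taut? F = ∀-local? (size M) (varBound F) (Holds-local F) (λ v → T? _)

    sound? : ∀ r → Dec (Sound M r)
    sound? (rule As B) =
      ∀-local? (size M) (varBoundList As ⊔ varBound B)
        (Local-→ (Local-mono (m≤m⊔n _ _) (All-Holds-local As))
                 (Local-mono (m≤n⊔m (varBoundList As) _) (Holds-local B)))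
        (λ v → All.all? (λ A → T? _) As →-dec T? _)

    cover? : (C : Calculus σ) → Dec (Cover M C)
    cover? C = All.all? taut? (Calculus.axioms C) ×-dec All.all? sound? (Calculus.rules C)

  module _ (M M' : Logic σ) (h : Fin (size M) → Fin (size M'))
           (h-op : ∀ c xs → h (op M c xs) ≡ op M' c (Vec.map h xs)) where

    mutual
      eval-homomorphic : ∀ {v v'} → (∀ x → h (v x) ≡ v' x) → ∀ F →
                         h (eval M v F) ≡ eval M' v' F
      eval-homomorphic hv (var x)    = hv x
      eval-homomorphic hv (app c Fs) = trans (h-op c _) (cong (op M' c) (evalVec-homomorphic hv Fs))

      evalVec-homomorphic : ∀ {m v v'} → (∀ x → h (v x) ≡ v' x) → (Fs : Vec (Formula σ) m) →
                            Vec.map h (evalVec M v Fs) ≡ evalVec M' v' Fs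
      evalVec-homomorphic hv []       = refl
      evalVec-homomorphic hv (F ∷ Fs) =
        cong₂ _∷_ (eval-homomorphic hv F) (evalVec-homomorphic hv Fs)

  Table : ℕ → Set
  Table t = (Fin t → Bool) × ((c : Fin (nConn σ)) → Vec (Fin t) (arity σ c) → Fin t)

  fromTable : ∀ {t} → Table t → Logic σ
  fromTable {t} p = record { size = t ; designated = proj₁ p ; op = proj₂ p }

  table : (M : Logic σ) → Table (size M)
  table M = designated M , op M

  _≗ᵀ_ : ∀ {t} → Table t → Table t → Set
  p ≗ᵀ q = proj₁ p ≗ proj₁ q × (∀ c → proj₂ p c ≗ proj₂ q c)

  ≗ᵀ-sym : ∀ {t} {p q : Table t} → p ≗ᵀ q → q ≗ᵀ p
  ≗ᵀ-sym (d≗ , o≗) = (λ x → sym (d≗ x)) , (λ c xs → sym (o≗ c xs))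

  Table-enumeration : ∀ t → Enumeration (Table t) _≗ᵀ_
  Table-enumeration t =
    ×-enumeration (Π-enumeration t (λ _ → Bool-enumeration))
                  (Π-enumeration (nConn σ) λ c →
                     Vec→-enumeration t (arity σ c) (Fin-enumeration t))

  module _ {t} {p q : Table t} (p≗q : p ≗ᵀ q) where

    eval-≗ᵀ : ∀ v F → eval (fromTable p) v F ≡ eval (fromTable q) v F
    eval-≗ᵀ v = eval-homomorphic (fromTable p) (fromTable q) id
                  (λ c xs → trans (proj₂ p≗q c xs) (cong (proj₂ q c) (sym (map-id xs))))
                  {v} (λ _ → refl)

    Holds-≗ᵀ : ∀ v F → Holds (fromTable p) v F → Holds (fromTable q) v F
    Holds-≗ᵀ v F = subst T (proj₁ p≗q _) ∘ subst (T ∘ proj₁ p) (eval-≗ᵀ v F)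

    Taut-≗ᵀ : ∀ F → Taut (fromTable p) F → Taut (fromTable q) F
    Taut-≗ᵀ F taut v = Holds-≗ᵀ v F (taut v)

  Sound-≗ᵀ : ∀ {t} {p q : Table t} → p ≗ᵀ q → ∀ r → Sound (fromTable p) r → Sound (fromTable q) r
  Sound-≗ᵀ p≗q r sound v hs =
    Holds-≗ᵀ p≗q v (Rule.conclusion r) (sound v (All.map (λ {A} → Holds-≗ᵀ (≗ᵀ-sym p≗q) v A) hs))

  Cover-≗ᵀ : ∀ {t} {p q : Table t} → p ≗ᵀ q → ∀ C → Cover (fromTable p) C → Cover (fromTable q) C
  Cover-≗ᵀ p≗q C (axs , rs) =
    All.map (λ {F} → Taut-≗ᵀ p≗q F) axs , All.map (λ {r} → Sound-≗ᵀ p≗q r) rs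

  Inhabited : Logic σ → Set
  Inhabited M = Fin (size M)

  trivial : Logic σ
  trivial = record { size = 1 ; designated = λ _ → true ; op = λ _ _ → zero }

  trivial-taut : ∀ F → Taut trivial F
  trivial-taut F v = tt

  _⊗_ : Logic σ → Logic σ → Logic σ
  M ⊗ M' = record
    { size       = size M * size M'
    ; designated = λ i → designated M (π₁ i) ∧ designated M' (π₂ {size M} i)
    ; op         = λ c xs → combine (op M c (Vec.map π₁ xs)) (op M' c (Vec.map (π₂ {size M}) xs))
    }

  module _ (M M' : Logic σ) where

    Holds-⊗ : ∀ {v v₁ v₂} → (∀ x → π₁ (v x) ≡ v₁ x) → (∀ x → π₂ {size M} (v x) ≡ v₂ x) → ∀ F →
              Holds (M ⊗ M') v F ⇔ (Holds M v₁ F × Holds M' v₂ F)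
    Holds-⊗ hv₁ hv₂ F =
      subst (_⇔ _) (cong₂ (λ x y → T (designated M x ∧ designated M' y))
                          (sym (eval-homomorphic (M ⊗ M') M π₁ π₁-op hv₁ F))
                          (sym (eval-homomorphic (M ⊗ M') M' (π₂ {size M}) π₂-op hv₂ F)))
            T-∧
      where
        π₁-op : ∀ c xs → π₁ (op (M ⊗ M') c xs) ≡ op M c (Vec.map π₁ xs)
        π₁-op c xs = π₁-combine _ _
        π₂-op : ∀ c xs → π₂ {size M} (op (M ⊗ M') c xs) ≡ op M' c (Vec.map (π₂ {size M}) xs)
        π₂-op c xs = π₂-combine {size M} _ _

    ⊗-intro : ∀ F → Taut M F → Taut M' F → Taut (M ⊗ M') F
    ⊗-intro F taut taut' v =
      Equivalence.from (Holds-⊗ (λ _ → refl) (λ _ → refl) F) (taut _ , taut' _)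

    ⊗-elimˡ : Inhabited M' → ∀ F → Taut (M ⊗ M') F → Taut M F
    ⊗-elimˡ e F taut v =
      proj₁ (Equivalence.to
               (Holds-⊗ (λ x → π₁-combine (v x) e) (λ x → π₂-combine {size M} (v x) e) F) (taut _))

    ⊗-elimʳ : Inhabited M → ∀ F → Taut (M ⊗ M') F → Taut M' F
    ⊗-elimʳ e F taut v =
      proj₂ (Equivalence.to
               (Holds-⊗ (λ x → π₁-combine e (v x)) (λ x → π₂-combine {size M} e (v x)) F) (taut _))

  ⨂ : List (Logic σ) → Logic σ
  ⨂ []       = trivial
  ⨂ (M ∷ Ms) = M ⊗ ⨂ Ms

  ⨂-intro : ∀ {Ms} F → All (λ M → Taut M F) Ms → Taut (⨂ Ms) F
  ⨂-intro          F []             = trivial-taut F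
  ⨂-intro {M ∷ Ms} F (taut ∷ tauts) = ⊗-intro M (⨂ Ms) F taut (⨂-intro F tauts)

  ⨂-inhabited : ∀ {Ms} → All Inhabited Ms → Inhabited (⨂ Ms)
  ⨂-inhabited []       = zero
  ⨂-inhabited (e ∷ es) = combine e (⨂-inhabited es)

  ⨂-elim : ∀ {Ms} → All Inhabited Ms → ∀ F → Taut (⨂ Ms) F → All (λ M → Taut M F) Ms
  ⨂-elim          []       F taut = []
  ⨂-elim {M ∷ Ms} (e ∷ es) F taut =
    ⊗-elimˡ M (⨂ Ms) (⨂-inhabited es) F taut ∷ ⨂-elim es F (⊗-elimʳ M (⨂ Ms) e F taut)

  module _ (C : Calculus σ) where

    coverOrTrivial : Logic σ → Logic σ
    coverOrTrivial M with cover? M C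
    ... | yes _ = M
    ... | no _  = trivial

    MC⇒Taut-coverOrTrivial : ∀ F → MC C F → ∀ M → Taut (coverOrTrivial M) F
    MC⇒Taut-coverOrTrivial F mc M with cover? M C
    ... | yes cover = mc M cover
    ... | no _      = trivial-taut F

    Taut-coverOrTrivial⇒Taut : ∀ F M → Cover M C → Taut (coverOrTrivial M) F → Taut M F
    Taut-coverOrTrivial⇒Taut F M cover taut with cover? M C
    ... | yes _     = taut
    ... | no ¬cover = ⊥-elim (¬cover cover)

    coverOrTrivial-inhabited : ∀ M → Inhabited M → Inhabited (coverOrTrivial M)
    coverOrTrivial-inhabited M e with cover? M C
    ... | yes _ = e
    ... | no _  = zero

    coverFactors : ℕ → List (Logic σ)
    coverFactors t = map (coverOrTrivial ∘ fromTable) (list (Table-enumeration t))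

    coversOfSize : ℕ → Logic σ
    coversOfSize t = ⨂ (coverFactors t)

    MC⇒Taut-coversOfSize : ∀ F → MC C F → ∀ t → Taut (coversOfSize t) F
    MC⇒Taut-coversOfSize F mc t =
      ⨂-intro F (All.map⁺ (universal (MC⇒Taut-coverOrTrivial F mc ∘ fromTable)
                                      (list (Table-enumeration t))))

    coverFactors-inhabited : ∀ s → All Inhabited (coverFactors (suc s))
    coverFactors-inhabited s =
      All.map⁺ (universal (λ p → coverOrTrivial-inhabited (fromTable p) zero)
                          (list (Table-enumeration (suc s))))

    coversOfSize-inhabited : ∀ s → Inhabited (coversOfSize (suc s))
    coversOfSize-inhabited s = ⨂-inhabited (coverFactors-inhabited s)

    Taut-coversOfSize⇒Taut : ∀ {s} F (p : Table (suc s)) → Cover (fromTable p) C →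
                             Taut (coversOfSize (suc s)) F → Taut (fromTable p) F
    Taut-coversOfSize⇒Taut {s} F p cover taut =
      let q , q≗p , taut-q = representative (Table-enumeration (suc s))
                               (All.map⁻ (⨂-elim (coverFactors-inhabited s) F taut)) p
      in Taut-≗ᵀ q≗p F
           (Taut-coverOrTrivial⇒Taut F (fromTable q) (Cover-≗ᵀ (≗ᵀ-sym q≗p) C cover) taut-q)

    approximation : ℕ → Logic σ
    approximation zero    = trivial
    approximation (suc s) = approximation s ⊗ coversOfSize (suc s)

    approximation-inhabited : ∀ i → Inhabited (approximation i)
    approximation-inhabited zero    = zero
    approximation-inhabited (suc i) =
      combine (approximation-inhabited i) (coversOfSize-inhabited i)

    approximation-antitone : ∀ {i j} → j ≤′ i → approximation i ⊴ approximation j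
    approximation-antitone         ≤′-refl        F taut = taut
    approximation-antitone {suc i} (≤′-step j≤′i) F taut =
      approximation-antitone j≤′i F
        (⊗-elimˡ (approximation i) (coversOfSize (suc i)) (coversOfSize-inhabited i) F taut)

    MC⇒Taut-approximation : ∀ F → MC C F → ∀ i → Taut (approximation i) F
    MC⇒Taut-approximation F mc zero    = trivial-taut F
    MC⇒Taut-approximation F mc (suc i) =
      ⊗-intro (approximation i) (coversOfSize (suc i)) F
        (MC⇒Taut-approximation F mc i) (MC⇒Taut-coversOfSize F mc (suc i))

    Taut-approximation⇒Taut : ∀ F → (∀ i → Taut (approximation i) F) →
                              ∀ {t} (p : Table t) → Cover (fromTable p) C → Taut (fromTable p) F
    Taut-approximation⇒Taut F taut {zero}  p cover v = ⊥-elim (¬Fin0 (v 0))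
    Taut-approximation⇒Taut F taut {suc s} p cover =
      Taut-coversOfSize⇒Taut F p cover
        (⊗-elimʳ (approximation s) (coversOfSize (suc s)) (approximation-inhabited s) F
                 (taut (suc s)))

proposition9 : (σ : Signature) (C : Calculus σ) → EffectiveSeqApprox (MC C)
proposition9 σ C =
  approximation C ,
  (λ i j j≤i → approximation-antitone C (≤⇒≤′ j≤i)) ,
  λ F → mk⇔ (MC⇒Taut-approximation C F) (λ taut M → Taut-approximation⇒Taut C F taut (table M))
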